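{- Every triangle-free graph of minimum degree $d\ge 1$ contains a semi-bipartite induced subgraph of average degree (with respect to its semi-bipartition) at least $\tfrac12\log d$.
   Context: All graphs are finite and simple; $\log$ is the natural logarithm. Given a graph $G$, an induced subgraph $G'$ of $G$ with vertex set $V'$ is semi-bipartite if it admits a partition $V'=V_1\cup V_2$ such that $V_1$ is a stable set of $G$. Its average degree with respect to this semi-bipartition is the average degree of the bipartite graph $G[V_1,V_2]$ with vertex set $V_1\cup V_2$ consisting of the edges of $G$ with one end in $V_1$ and the other in $V_2$ (edges inside $V_2$ are ignored), i.e. $2e(V_1,V_2)/(|V_1|+|V_2|)$. -}

module Defs where

open import Data.Nat using (ℕ; zero; suc; _+_; _*_; _^_; _≤_; _!)

open import Data.Fin using (Fin; zero; suc)
open import Data.Bool using (Bool; true; false; T; if_then_else_; _∧_)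
open import Data.Product using (Σ; ∃; _×_; _,_)
open import Relation.Nullary using (¬_)
open import Relation.Binary.PropositionalEquality using (_≡_)

record Graph (n : ℕ) : Set where
  field
    adj   : Fin n → Fin n → Bool
    sym   : ∀ x y → adj x y ≡ adj y x
    irrefl : ∀ x → adj x x ≡ false
open Graph public

count : ∀ {n} → (Fin n → Bool) → ℕ
count {zero}  p = 0
count {suc n} p = (if p zero then 1 else 0) + count (λ i → p (suc i))

VSet : ℕ → Set
VSet n = Fin n → Bool

size : ∀ {n} → VSet n → ℕ
size S = count S

degree : ∀ {n} → Graph n → Fin n → ℕ
degree G x = count (adj G x)

TriangleFree : ∀ {n} → Graph n → Set
TriangleFree G = ∀ x y z → ¬ (T (adj G x y) × T (adj G y z) × T (adj G x z))

MinDegree : ∀ {n} → Graph n → ℕ → Set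
MinDegree {n} G d = (∀ x → d ≤ degree G x) × (Σ (Fin n) λ x → degree G x ≡ d)

Disjoint : ∀ {n} → VSet n → VSet n → Set
Disjoint A B = ∀ x → ¬ (T (A x) × T (B x))

Stable : ∀ {n} → Graph n → VSet n → Set
Stable G A = ∀ x y → T (A x) → T (A y) → ¬ T (adj G x y)

-- e(V1,V2): number of edges with one end in V1 and the other in V2
-- (counted as ordered pairs (x,y), x ∈ V1, y ∈ V2; for disjoint V1, V2
-- this counts each such edge exactly once)
sumFin : ∀ {n} → (Fin n → ℕ) → ℕ
sumFin {zero}  f = 0
sumFin {suc n} f = f zero + sumFin (λ i → f (suc i))

crossEdges : ∀ {n} → Graph n → VSet n → VSet n → ℕ
crossEdges G A B =
  sumFin λ x → if A x then count (λ y → B y ∧ adj G x y) else 0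

-- Encoding of the real exponential with natural-number arithmetic only.
-- expScaled x N = N! * Σ_{k=0}^{N} x^k / k!   (a natural number).
expScaled : ℕ → ℕ → ℕ
expScaled x zero    = 1
expScaled x (suc N) = suc N * expScaled x N + x ^ suc N

-- ExpAtLeast x y  means  exp(x) ≥ y  (x, y natural numbers).
-- Since the partial sums of the exponential series increase to exp(x),
-- and exp(x) is irrational for x ≥ 1 (while exp 0 = 1 = first partial sum),
-- exp(x) ≥ y holds iff some partial sum is ≥ y.
ExpAtLeast : ℕ → ℕ → Set
ExpAtLeast x y = ∃ λ N → y * (N !) ≤ expScaled x N

-- Semi-bipartite induced subgraph G[V1 ∪ V2] with V1 stable, V1 ∩ V2 = ∅,
-- nonempty (so its average degree is defined).
SemiBipartition : ∀ {n} → Graph n → VSet n → VSet n → Set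
SemiBipartition G V1 V2 = Disjoint V1 V2 × Stable G V1 × (1 ≤ size V1 + size V2)

-- average degree 2 e(V1,V2)/(|V1|+|V2|) ≥ (1/2) log d
--   ⇔ 4 e(V1,V2) / (|V1|+|V2|) ≥ log d
--   ⇔ exp(4 e(V1,V2)) ≥ d ^ (|V1|+|V2|)
AvgDegAtLeastHalfLog : ∀ {n} → Graph n → VSet n → VSet n → ℕ → Set
AvgDegAtLeastHalfLog G V1 V2 d =
  ExpAtLeast (4 * crossEdges G V1 V2) (d ^ (size V1 + size V2))

-- Shearer-type averaging over the independent sets of G.  Choose k with 2^k ≤ d ≤ 2^(k+1) and
-- put K = k + 2.  Fix a vertex v and an independent set W₁ avoiding the closed neighbourhood
-- N[v].  Because G is triangle-free, N(v) is independent, so the independent sets W₁ ∪ W₂ with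
-- W₂ ⊆ N[v] are W₁ ∪ {v} and W₁ ∪ S for the 2^X subsets S of the X neighbours of v that have no
-- neighbour in W₁.  Over these sets, K·[v ∈ W ∪ N(W)] sums to K·2^X, while
-- 2·(deg v·[v ∈ W] + |N(v) ∩ W|) sums to X·2^X + 2·deg v ≥ X·2^X + 2^(k+1) ≥ K·2^X.
-- Summing over v and W₁: the sum of K·|W ∪ N(W)| over all independent W is at most the sum of
-- 4·e(W, N(W)), so some nonempty independent W has K·s ≤ 4·m, where s = |W| + |N(W)| and
-- m = e(W, N(W)).  Hence (W, N(W)) is a semi-bipartition of average degree 2m/s ≥ (k + 2)/2,
-- and indeed exp(4m) ≥ 2^(4m - 1) ≥ 2^((k+1)s) ≥ d^s.
{-# OPTIONS --safe #-}
module Submission where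

open import Defs hiding (sym)
open import Data.Bool using (Bool; true; false; T; if_then_else_; _∧_; _∨_)
open import Data.Bool.Properties using (∧-identityʳ; ∧-zeroʳ; T-≡; T-∧)
open import Data.Empty using (⊥-elim)
open import Data.Fin using (Fin; zero; suc)
open import Data.Fin.Properties using (any?; all?)
open import Data.Fin.Subset
open import Data.Fin.Subset.Properties
open import Data.Nat using (ℕ; zero; suc; _+_; _*_; _^_; _≤_; _<_; z≤n; s≤s; _!; _≤?_; _<?_; NonZero)
open import Data.Nat.Properties
open import Data.Nat.Solver using (module +-*-Solver)
open import Data.Product using (∃; Σ; _×_; _,_)
open import Data.Sum using (_⊎_; inj₁; inj₂)
open import Data.Vec using ([]; _∷_; here; there; tabulate)
open import Data.Vec.Properties using (lookup∘tabulate; lookup⇒[]=; []=⇒lookup)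
open import Function using (_∘_)
open import Function.Bundles using (Equivalence)
open import Relation.Nullary using (¬_; Dec; yes; no; does; contradiction; ¬?)
open import Relation.Nullary.Decidable using (T?; _×-dec_; _⊎-dec_; _→-dec_; dec-true; dec-false)
open import Relation.Binary.PropositionalEquality
open import Algebra.Properties.CommutativeMonoid.Sum +-0-commutativeMonoid
  using (sum-syntax; sum-cong-≗; ∑-distrib-+; ∑-comm; sum-replicate-zero)
open import Algebra.Properties.CommutativeSemigroup +-commutativeSemigroup using (interchange)
open import Algebra.Properties.Semiring.Sum +-*-semiring using (*-distribˡ-sum)

open +-*-Solver

private variable n : ℕ

n<2^n : ∀ n → n < 2 ^ n
n<2^n zero    = s≤s z≤n
n<2^n (suc n) = +-mono-≤ (m^n>0 2 n) (m≤n⇒m≤n+o 0 (n<2^n n))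

[2+k]*2^x≤2*2^k+x*2^x : ∀ k x → (2 + k) * 2 ^ x ≤ 2 * 2 ^ k + x * 2 ^ x
[2+k]*2^x≤2*2^k+x*2^x k x with 2 + k ≤? x
... | yes 2+k≤x = ≤-trans (*-monoˡ-≤ (2 ^ x) 2+k≤x) (m≤n+m _ _)
... | no  2+k≰x with m≤n⇒∃[o]m+o≡n (≤-pred (≰⇒> 2+k≰x))
...   | i , x+i≡1+k = subst (λ m → suc m * 2 ^ x ≤ 2 ^ m + x * 2 ^ x) x+i≡1+k (begin
  suc (x + i) * 2 ^ x         ≡⟨ solve 3 (λ x i p → (con 1 :+ (x :+ i)) :* p := (con 1 :+ i) :* p :+ x :* p)
                                         refl x i (2 ^ x) ⟩
  suc i * 2 ^ x + x * 2 ^ x   ≤⟨ +-monoˡ-≤ (x * 2 ^ x) (*-monoˡ-≤ (2 ^ x) (n<2^n i)) ⟩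
  2 ^ i * 2 ^ x + x * 2 ^ x   ≡⟨ cong (_+ x * 2 ^ x) (trans (*-comm (2 ^ i) (2 ^ x)) (sym (^-distribˡ-+-* 2 x i))) ⟩
  2 ^ (x + i) + x * 2 ^ x     ∎)
  where open ≤-Reasoning

bernoulli : ∀ j i → j ^ i * (j + i) ≤ suc j ^ i * j
bernoulli j zero    = ≤-reflexive (solve 1 (λ j → con 1 :* (j :+ con 0) := con 1 :* j) refl j)
bernoulli j (suc i) = begin
  j * j ^ i * (j + suc i)              ≤⟨ m≤m+n _ (j ^ i * i) ⟩
  j * j ^ i * (j + suc i) + j ^ i * i  ≡⟨ solve 3 (λ j p i → j :* p :* (j :+ (con 1 :+ i)) :+ p :* i
                                                       := (con 1 :+ j) :* (p :* (j :+ i))) refl j (j ^ i) i ⟩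
  suc j * (j ^ i * (j + i))            ≤⟨ *-monoʳ-≤ (suc j) (bernoulli j i) ⟩
  suc j * (suc j ^ i * j)              ≡⟨ *-assoc (suc j) (suc j ^ i) j ⟨
  suc j * suc j ^ i * j                ∎
  where open ≤-Reasoning

2*n^n≤[1+n]^n : ∀ n .{{_ : NonZero n}} → 2 * n ^ n ≤ suc n ^ n
2*n^n≤[1+n]^n n = *-cancelʳ-≤ (2 * n ^ n) (suc n ^ n) n
  (subst (_≤ suc n ^ n * n) (solve 2 (λ p n → p :* (n :+ n) := con 2 :* p :* n) refl (n ^ n) n) (bernoulli n n))

2^n*n!≤2*n^n : ∀ n → 2 ^ n * n ! ≤ 2 * n ^ n
2^n*n!≤2*n^n zero            = s≤s z≤n
2^n*n!≤2*n^n (suc zero)      = ≤-refl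
2^n*n!≤2*n^n (suc n@(suc _)) = begin
  2 ^ suc n * (suc n !)        ≡⟨ solve 3 (λ p s f → con 2 :* p :* (s :* f) := s :* (con 2 :* (p :* f)))
                                          refl (2 ^ n) (suc n) (n !) ⟩
  suc n * (2 * (2 ^ n * n !))  ≤⟨ *-monoʳ-≤ (suc n) (*-monoʳ-≤ 2 (2^n*n!≤2*n^n n)) ⟩
  suc n * (2 * (2 * n ^ n))    ≤⟨ *-monoʳ-≤ (suc n) (*-monoʳ-≤ 2 (2*n^n≤[1+n]^n n)) ⟩
  suc n * (2 * suc n ^ n)      ≡⟨ solve 2 (λ s p → s :* (con 2 :* p) := con 2 :* (s :* p)) refl (suc n) (suc n ^ n) ⟩
  2 * suc n ^ suc n            ∎
  where open ≤-Reasoning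

^≤expScaled : ∀ x N → x ^ N ≤ expScaled x N
^≤expScaled x zero    = ≤-refl
^≤expScaled x (suc N) = m≤n+m (x ^ suc N) (suc N * expScaled x N)

-- Already the single term x^x / x! of the series is at least 2^(x - 1).
expAtLeast : ∀ x y → 2 * y ≤ 2 ^ x → ExpAtLeast x y
expAtLeast x y 2y≤2^x = x , *-cancelˡ-≤ 2 (begin
  2 * (y * x !)      ≡⟨ *-assoc 2 y (x !) ⟨
  2 * y * x !        ≤⟨ *-monoˡ-≤ (x !) 2y≤2^x ⟩
  2 ^ x * x !        ≤⟨ 2^n*n!≤2*n^n x ⟩
  2 * x ^ x          ≤⟨ *-monoʳ-≤ 2 (^≤expScaled x x) ⟩
  2 * expScaled x x  ∎)
  where open ≤-Reasoning

expAtLeast-^ : ∀ k {d s} x → 1 ≤ s → d ≤ 2 ^ suc k → (2 + k) * s ≤ x → ExpAtLeast x (d ^ s)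
expAtLeast-^ k {d} {s} x 1≤s d≤2^[1+k] [2+k]s≤x = expAtLeast x (d ^ s) (begin
  2 * d ^ s            ≤⟨ *-monoʳ-≤ 2 (^-monoˡ-≤ s d≤2^[1+k]) ⟩
  2 * (2 ^ suc k) ^ s  ≡⟨ cong (2 *_) (^-*-assoc 2 (suc k) s) ⟩
  2 ^ (1 + suc k * s)  ≤⟨ ^-monoʳ-≤ 2 (+-monoˡ-≤ (suc k * s) 1≤s) ⟩
  2 ^ ((2 + k) * s)    ≤⟨ ^-monoʳ-≤ 2 [2+k]s≤x ⟩
  2 ^ x                ∎)
  where open ≤-Reasoning

∃[k]2^k≤n≤2^[1+k] : ∀ n → 1 ≤ n → ∃ λ k → 2 ^ k ≤ n × n ≤ 2 ^ suc k
∃[k]2^k≤n≤2^[1+k] n 1≤n = search n (<⇒≤ (n<2^n n))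
  where
  search : ∀ m → n ≤ 2 ^ m → ∃ λ k → 2 ^ k ≤ n × n ≤ 2 ^ suc k
  search zero    n≤1 = 0 , 1≤n , m≤n⇒m≤n+o _ n≤1
  search (suc m) n≤2^[1+m] with n ≤? 2 ^ m
  ... | yes n≤2^m = search m n≤2^m
  ... | no  n≰2^m = m , <⇒≤ (≰⇒> n≰2^m) , n≤2^[1+m]

m+n<o+p⇒m<o⊎n<p : ∀ m n o p → m + n < o + p → m < o ⊎ n < p
m+n<o+p⇒m<o⊎n<p m n o p m+n<o+p with m <? o
... | yes m<o = inj₁ m<o
... | no  m≮o = inj₂ (+-cancelˡ-< o n p (≤-<-trans (+-monoˡ-≤ n (≮⇒≥ m≮o)) m+n<o+p))

𝟙 : Bool → ℕ
𝟙 b = if b then 1 else 0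

𝟙≤1 : ∀ b → 𝟙 b ≤ 1
𝟙≤1 true  = ≤-refl
𝟙≤1 false = z≤n

𝟙-mono-≤ : ∀ {a b} → (T a → T b) → 𝟙 a ≤ 𝟙 b
𝟙-mono-≤ {false}         _   = z≤n
𝟙-mono-≤ {true}  {true}  _   = ≤-refl
𝟙-mono-≤ {true}  {false} a⇒b with () ← a⇒b _

m*𝟙b≤m : ∀ m b → m * 𝟙 b ≤ m
m*𝟙b≤m m b = ≤-trans (*-monoʳ-≤ m (𝟙≤1 b)) (≤-reflexive (*-identityʳ m))

does⁻ : ∀ {p} {P : Set p} (P? : Dec P) → T (does P?) → P
does⁻ (yes p) _ = p

does⁺ : ∀ {p} {P : Set p} (P? : Dec P) → P → T (does P?)
does⁺ (yes _) _ = _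
does⁺ (no ¬p) p = ¬p p

sumFin≡∑ : ∀ (f : Fin n → ℕ) → sumFin f ≡ ∑[ i < n ] f i
sumFin≡∑ {zero}  f = refl
sumFin≡∑ {suc n} f = cong (f zero +_) (sumFin≡∑ (f ∘ suc))

∑-mono-≤ : ∀ {f g : Fin n → ℕ} → (∀ i → f i ≤ g i) → ∑[ i < n ] f i ≤ ∑[ i < n ] g i
∑-mono-≤ {zero}  f≤g = z≤n
∑-mono-≤ {suc n} f≤g = +-mono-≤ (f≤g zero) (∑-mono-≤ (f≤g ∘ suc))

count≡∑𝟙 : ∀ (p : Fin n → Bool) → count p ≡ ∑[ i < n ] 𝟙 (p i)
count≡∑𝟙 {zero}  p = refl
count≡∑𝟙 {suc n} p = cong (𝟙 (p zero) +_) (count≡∑𝟙 (p ∘ suc))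

count-cong : ∀ {p q : Fin n → Bool} → (∀ x → p x ≡ q x) → count p ≡ count q
count-cong {zero}  p≗q = refl
count-cong {suc n} p≗q = cong₂ _+_ (cong 𝟙 (p≗q zero)) (count-cong (p≗q ∘ suc))

count-mono-≤ : ∀ {p q : Fin n → Bool} → (∀ x → T (p x) → T (q x)) → count p ≤ count q
count-mono-≤ {zero}  p⇒q = z≤n
count-mono-≤ {suc n} p⇒q = +-mono-≤ (𝟙-mono-≤ (p⇒q zero)) (count-mono-≤ (p⇒q ∘ suc))

count-∨ : ∀ (p q : Fin n → Bool) → (∀ x → T (p x) → ¬ T (q x)) → count (λ x → p x ∨ q x) ≡ count p + count q
count-∨ {zero}  p q p∩q=∅ = refl
count-∨ {suc n} p q p∩q=∅ = trans
  (cong₂ _+_ (𝟙-∨ (p zero) (q zero) (p∩q=∅ zero)) (count-∨ (p ∘ suc) (q ∘ suc) (p∩q=∅ ∘ suc)))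
  (interchange (𝟙 (p zero)) (𝟙 (q zero)) (count (p ∘ suc)) (count (q ∘ suc)))
  where
  𝟙-∨ : ∀ a b → (T a → ¬ T b) → 𝟙 (a ∨ b) ≡ 𝟙 a + 𝟙 b
  𝟙-∨ true  true  a⇒¬b = contradiction _ (a⇒¬b _)
  𝟙-∨ true  false _    = refl
  𝟙-∨ false b     _    = refl

1≤count : ∀ (p : Fin n → Bool) x → T (p x) → 1 ≤ count p
1≤count p zero    px = ≤-trans (𝟙-mono-≤ {true} (λ _ → px)) (m≤m+n _ _)
1≤count p (suc x) px = ≤-trans (1≤count (p ∘ suc) x px) (m≤n+m _ _)

∣p∣≡count-∈ : ∀ (p : Subset n) → ∣ p ∣ ≡ count (λ x → does (x ∈? p))
∣p∣≡count-∈ []            = refl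
∣p∣≡count-∈ (outside ∷ p) = ∣p∣≡count-∈ p
∣p∣≡count-∈ (inside  ∷ p) = cong suc (∣p∣≡count-∈ p)

∈-tabulate⁺ : ∀ {f : Fin n → Bool} {x} → T (f x) → x ∈ tabulate f
∈-tabulate⁺ {f = f} {x} fx = lookup⇒[]= x (tabulate f) (trans (lookup∘tabulate f x) (Equivalence.to T-≡ fx))

∈-tabulate⁻ : ∀ {f : Fin n → Bool} {x} → x ∈ tabulate f → T (f x)
∈-tabulate⁻ {f = f} {x} x∈f = Equivalence.from T-≡ (trans (sym (lookup∘tabulate f x)) ([]=⇒lookup x∈f))

toVSet : Subset n → VSet n
toVSet W x = does (x ∈? W)

-- Sums over the subsets of a set

-- Subsets are bit vectors, so that (s ∷ W₁) ∪ (t ∷ W₂) reduces to (s ∨ t) ∷ (W₁ ∪ W₂) and summands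
-- need not respect pointwise equality of characteristic functions.
sumSubsets : Subset n → (Subset n → ℕ) → ℕ
sumSubsets []            f = f []
sumSubsets (outside ∷ M) f = sumSubsets M (f ∘ (outside ∷_))
sumSubsets (inside  ∷ M) f = sumSubsets M (f ∘ (outside ∷_)) + sumSubsets M (f ∘ (inside ∷_))

infixl 10 sumSubsets
syntax sumSubsets M (λ W → e) = ∑[ W ⊆ M ] e

sumSubsets-cong : ∀ (M : Subset n) {f g : Subset n → ℕ} → (∀ W → f W ≡ g W) → sumSubsets M f ≡ sumSubsets M g
sumSubsets-cong []            f≗g = f≗g []
sumSubsets-cong (outside ∷ M) f≗g = sumSubsets-cong M (f≗g ∘ (outside ∷_))
sumSubsets-cong (inside  ∷ M) f≗g =
  cong₂ _+_ (sumSubsets-cong M (f≗g ∘ (outside ∷_))) (sumSubsets-cong M (f≗g ∘ (inside ∷_)))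

sumSubsets-mono-≤ : ∀ (M : Subset n) {f g : Subset n → ℕ} → (∀ W → W ⊆ M → f W ≤ g W) →
                    sumSubsets M f ≤ sumSubsets M g
sumSubsets-mono-≤ []            f≤g = f≤g [] (λ ())
sumSubsets-mono-≤ (outside ∷ M) f≤g = sumSubsets-mono-≤ M (λ W W⊆M → f≤g (outside ∷ W) (out⊆ W⊆M))
sumSubsets-mono-≤ (inside  ∷ M) f≤g = +-mono-≤ (sumSubsets-mono-≤ M (λ W W⊆M → f≤g (outside ∷ W) (out⊆ W⊆M)))
                                               (sumSubsets-mono-≤ M (λ W W⊆M → f≤g (inside ∷ W) (s⊆s W⊆M)))

sumSubsets-distrib-+ : ∀ (M : Subset n) (f g : Subset n → ℕ) →
                       ∑[ W ⊆ M ] (f W + g W) ≡ sumSubsets M f + sumSubsets M g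
sumSubsets-distrib-+ []            f g = refl
sumSubsets-distrib-+ (outside ∷ M) f g = sumSubsets-distrib-+ M (f ∘ (outside ∷_)) (g ∘ (outside ∷_))
sumSubsets-distrib-+ (inside  ∷ M) f g = trans
  (cong₂ _+_ (sumSubsets-distrib-+ M (f ∘ (outside ∷_)) (g ∘ (outside ∷_)))
             (sumSubsets-distrib-+ M (f ∘ (inside ∷_)) (g ∘ (inside ∷_))))
  (interchange (sumSubsets M (f ∘ (outside ∷_))) (sumSubsets M (g ∘ (outside ∷_)))
               (sumSubsets M (f ∘ (inside ∷_))) (sumSubsets M (g ∘ (inside ∷_))))

*-distribˡ-sumSubsets : ∀ c (M : Subset n) (f : Subset n → ℕ) → c * sumSubsets M f ≡ ∑[ W ⊆ M ] (c * f W)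
*-distribˡ-sumSubsets c []            f = refl
*-distribˡ-sumSubsets c (outside ∷ M) f = *-distribˡ-sumSubsets c M (f ∘ (outside ∷_))
*-distribˡ-sumSubsets c (inside  ∷ M) f = trans (*-distribˡ-+ c _ _)
  (cong₂ _+_ (*-distribˡ-sumSubsets c M (f ∘ (outside ∷_))) (*-distribˡ-sumSubsets c M (f ∘ (inside ∷_))))

sumSubsets-zero : ∀ (M : Subset n) → ∑[ W ⊆ M ] 0 ≡ 0
sumSubsets-zero M = sym (*-distribˡ-sumSubsets 0 M (λ _ → 0))

sumSubsets-const : ∀ (M : Subset n) c → ∑[ W ⊆ M ] c ≡ 2 ^ ∣ M ∣ * c
sumSubsets-const []            c = sym (+-identityʳ c)
sumSubsets-const (outside ∷ M) c = sumSubsets-const M c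
sumSubsets-const (inside  ∷ M) c = trans (cong₂ _+_ (sumSubsets-const M c) (sumSubsets-const M c))
  (solve 2 (λ p c → p :* c :+ p :* c := con 2 :* p :* c) refl (2 ^ ∣ M ∣) c)

2*sumSubsets-∣∣ : ∀ (M : Subset n) → 2 * (∑[ W ⊆ M ] ∣ W ∣) ≡ ∣ M ∣ * 2 ^ ∣ M ∣
2*sumSubsets-∣∣ []            = refl
2*sumSubsets-∣∣ (outside ∷ M) = 2*sumSubsets-∣∣ M
2*sumSubsets-∣∣ (inside  ∷ M) = begin
  2 * (S + ∑[ W ⊆ M ] (1 + ∣ W ∣))    ≡⟨ cong (λ t → 2 * (S + t)) (sumSubsets-distrib-+ M (λ _ → 1) ∣_∣) ⟩
  2 * (S + (∑[ W ⊆ M ] 1 + S))        ≡⟨ cong (λ t → 2 * (S + (t + S))) (sumSubsets-const M 1) ⟩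
  2 * (S + (2 ^ m * 1 + S))           ≡⟨ solve 2 (λ S p → con 2 :* (S :+ (p :* con 1 :+ S))
                                                   := con 2 :* S :+ con 2 :* S :+ con 2 :* p) refl S (2 ^ m) ⟩
  2 * S + 2 * S + 2 * 2 ^ m           ≡⟨ cong (λ t → t + t + 2 * 2 ^ m) (2*sumSubsets-∣∣ M) ⟩
  m * 2 ^ m + m * 2 ^ m + 2 * 2 ^ m   ≡⟨ solve 2 (λ m p → m :* p :+ m :* p :+ con 2 :* p := (con 1 :+ m) :* (con 2 :* p))
                                                 refl m (2 ^ m) ⟩
  suc m * 2 ^ suc m                   ∎
  where
  open ≡-Reasoning
  S = ∑[ W ⊆ M ] ∣ W ∣
  m = ∣ M ∣

sumSubsets-restrict : ∀ (M F : Subset n) (f : Subset n → ℕ) →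
                      ∑[ W ⊆ M ] (if does (W ⊆? F) then f W else 0) ≡ ∑[ W ⊆ M ∩ F ] f W
sumSubsets-restrict []            []            f = refl
sumSubsets-restrict (outside ∷ M) (_       ∷ F) f = sumSubsets-restrict M F (f ∘ (outside ∷_))
sumSubsets-restrict (inside  ∷ M) (outside ∷ F) f =
  trans (cong₂ _+_ (sumSubsets-restrict M F (f ∘ (outside ∷_))) (sumSubsets-zero M)) (+-identityʳ _)
sumSubsets-restrict (inside  ∷ M) (inside  ∷ F) f =
  cong₂ _+_ (sumSubsets-restrict M F (f ∘ (outside ∷_))) (sumSubsets-restrict M F (f ∘ (inside ∷_)))

sumSubsets-⊥ : ∀ n (f : Subset n → ℕ) → sumSubsets ⊥ f ≡ f ⊥
sumSubsets-⊥ zero    f = refl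
sumSubsets-⊥ (suc n) f = sumSubsets-⊥ n (f ∘ (outside ∷_))

sumSubsets-⁅⁆ : ∀ (v : Fin n) (f : Subset n → ℕ) → sumSubsets ⁅ v ⁆ f ≡ f ⊥ + f ⁅ v ⁆
sumSubsets-⁅⁆ {suc n} zero    f = cong₂ _+_ (sumSubsets-⊥ n (f ∘ (outside ∷_))) (sumSubsets-⊥ n (f ∘ (inside ∷_)))
sumSubsets-⁅⁆         (suc v) f = sumSubsets-⁅⁆ v (f ∘ (outside ∷_))

sumSubsets-∪ : ∀ (A B : Subset n) → (∀ {x} → x ∈ A → x ∉ B) → (f : Subset n → ℕ) →
               sumSubsets (A ∪ B) f ≡ ∑[ W₁ ⊆ A ] ∑[ W₂ ⊆ B ] f (W₁ ∪ W₂)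
sumSubsets-∪ []      []      A∩B=∅ f = refl
sumSubsets-∪ (s ∷ A) (t ∷ B) A∩B=∅ f = go s t A∩B=∅
  where
  rec : ∀ s → sumSubsets (A ∪ B) (f ∘ (s ∷_)) ≡ ∑[ W₁ ⊆ A ] ∑[ W₂ ⊆ B ] f (s ∷ (W₁ ∪ W₂))
  rec s = sumSubsets-∪ A B (λ x∈A x∈B → A∩B=∅ (there x∈A) (there x∈B)) (f ∘ (s ∷_))
  go : ∀ s t → (∀ {x} → x ∈ s ∷ A → x ∉ t ∷ B) →
       sumSubsets ((s ∷ A) ∪ (t ∷ B)) f ≡ ∑[ W₁ ⊆ s ∷ A ] ∑[ W₂ ⊆ t ∷ B ] f (W₁ ∪ W₂)
  go outside outside _     = rec outside
  go inside  outside _     = cong₂ _+_ (rec outside) (rec inside)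
  go outside inside  _     = trans (cong₂ _+_ (rec outside) (rec inside)) (sym (sumSubsets-distrib-+ A _ _))
  go inside  inside  A∩B=∅ = ⊥-elim (A∩B=∅ here here)

sumSubsets-insert : ∀ {v : Fin n} {M : Subset n} → v ∉ M → (f : Subset n → ℕ) →
                    sumSubsets (⁅ v ⁆ ∪ M) f ≡ sumSubsets M f + ∑[ W ⊆ M ] f (⁅ v ⁆ ∪ W)
sumSubsets-insert {v = v} {M} v∉M f = begin
  sumSubsets (⁅ v ⁆ ∪ M) f                          ≡⟨ sumSubsets-∪ ⁅ v ⁆ M ⁅v⁆∩M=∅ f ⟩
  ∑[ W₁ ⊆ ⁅ v ⁆ ] ∑[ W₂ ⊆ M ] f (W₁ ∪ W₂)            ≡⟨ sumSubsets-⁅⁆ v _ ⟩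
  ∑[ W ⊆ M ] f (⊥ ∪ W) + ∑[ W ⊆ M ] f (⁅ v ⁆ ∪ W)   ≡⟨ cong (_+ ∑[ W ⊆ M ] f (⁅ v ⁆ ∪ W))
                                                            (sumSubsets-cong M (cong f ∘ ∪-identityˡ)) ⟩
  sumSubsets M f + ∑[ W ⊆ M ] f (⁅ v ⁆ ∪ W)          ∎
  where
  open ≡-Reasoning
  ⁅v⁆∩M=∅ : ∀ {x} → x ∈ ⁅ v ⁆ → x ∉ M
  ⁅v⁆∩M=∅ x∈⁅v⁆ = subst (_∉ M) (sym (x∈⁅y⁆⇒x≡y v x∈⁅v⁆)) v∉M

≤-sumSubsets : ∀ {M W : Subset n} (f : Subset n → ℕ) → W ⊆ M → f W ≤ sumSubsets M f
≤-sumSubsets {M = []}          {[]}          f _   = ≤-refl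
≤-sumSubsets {M = outside ∷ M} {outside ∷ W} f W⊆M = ≤-sumSubsets (f ∘ (outside ∷_)) (drop-∷-⊆ W⊆M)
≤-sumSubsets {M = inside  ∷ M} {outside ∷ W} f W⊆M =
  ≤-trans (≤-sumSubsets (f ∘ (outside ∷_)) (drop-∷-⊆ W⊆M)) (m≤m+n _ _)
≤-sumSubsets {M = inside  ∷ M} {inside  ∷ W} f W⊆M =
  ≤-trans (≤-sumSubsets (f ∘ (inside ∷_)) (drop-∷-⊆ W⊆M)) (m≤n+m _ _)
≤-sumSubsets {M = outside ∷ M} {inside  ∷ W} f W⊆M with () ← W⊆M here

sumSubsets-<⇒∃< : ∀ (M : Subset n) (f g : Subset n → ℕ) → sumSubsets M f < sumSubsets M g →
                  ∃ λ W → f W < g W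
sumSubsets-<⇒∃< []            f g f<g = [] , f<g
sumSubsets-<⇒∃< (outside ∷ M) f g f<g with sumSubsets-<⇒∃< M (f ∘ (outside ∷_)) (g ∘ (outside ∷_)) f<g
... | W , fW<gW = outside ∷ W , fW<gW
sumSubsets-<⇒∃< (inside  ∷ M) f g f<g with m+n<o+p⇒m<o⊎n<p _ _ _ _ f<g
... | inj₁ f₀<g₀ with sumSubsets-<⇒∃< M (f ∘ (outside ∷_)) (g ∘ (outside ∷_)) f₀<g₀
...   | W , fW<gW = outside ∷ W , fW<gW
sumSubsets-<⇒∃< (inside  ∷ M) f g f<g | inj₂ f₁<g₁
  with sumSubsets-<⇒∃< M (f ∘ (inside ∷_)) (g ∘ (inside ∷_)) f₁<g₁
...   | W , fW<gW = inside ∷ W , fW<gW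

∑-sumSubsets-comm : ∀ {m} (M : Subset n) (F : Fin m → Subset n → ℕ) →
                    ∑[ i < m ] sumSubsets M (F i) ≡ ∑[ W ⊆ M ] ∑[ i < m ] F i W
∑-sumSubsets-comm {m = zero}  M F = sym (sumSubsets-zero M)
∑-sumSubsets-comm {m = suc m} M F = trans (cong (sumSubsets M (F zero) +_) (∑-sumSubsets-comm M (F ∘ suc)))
  (sym (sumSubsets-distrib-+ M (F zero) (λ W → ∑[ i < m ] F (suc i) W)))

module _ {n} (G : Graph n) where

  adj-sym : ∀ {x y} → T (adj G x y) → T (adj G y x)
  adj-sym {x} {y} = subst T (Graph.sym G x y)

  adj-irrefl : ∀ {x} → ¬ T (adj G x x)
  adj-irrefl {x} = subst T (irrefl G x)

  HasNeighbourIn : Subset n → Fin n → Set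
  HasNeighbourIn W x = ∃ λ y → T (adj G x y) × y ∈ W

  hasNeighbourIn? : ∀ W x → Dec (HasNeighbourIn W x)
  hasNeighbourIn? W x = any? λ y → T? (adj G x y) ×-dec y ∈? W

  neighbourhood : Subset n → VSet n
  neighbourhood W x = does (hasNeighbourIn? W x)

  Covered : Subset n → Fin n → Set
  Covered W x = x ∈ W ⊎ HasNeighbourIn W x

  covered? : ∀ W x → Dec (Covered W x)
  covered? W x = x ∈? W ⊎-dec hasNeighbourIn? W x

  coverCount : Subset n → ℕ
  coverCount W = count (λ x → does (covered? W x))

  1≤coverCount : ∀ {W} → Nonempty W → 1 ≤ coverCount W
  1≤coverCount {W} (x , x∈W) = 1≤count (λ x → does (covered? W x)) x (does⁺ (covered? W x) (inj₁ x∈W))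

  Independent : Subset n → Set
  Independent W = ∀ x y → x ∈ W → y ∈ W → ¬ T (adj G x y)

  independent? : ∀ W → Dec (Independent W)
  independent? W = all? λ x → all? λ y → x ∈? W →-dec y ∈? W →-dec ¬? (T? (adj G x y))

  independent-⊆ : ∀ {W₁ W} → W₁ ⊆ W → Independent W → Independent W₁
  independent-⊆ W₁⊆W indW x y x∈W₁ y∈W₁ = indW x y (W₁⊆W x∈W₁) (W₁⊆W y∈W₁)

  independent-⁅⁆ : ∀ v → Independent ⁅ v ⁆
  independent-⁅⁆ v x y x∈ y∈ rewrite x∈⁅y⁆⇒x≡y v x∈ | x∈⁅y⁆⇒x≡y v y∈ = adj-irrefl

  volume : Subset n → ℕ
  volume W = ∑[ x < n ] (if does (x ∈? W) then degree G x else 0)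

  volume-empty : ∀ {W} → Empty W → volume W ≡ 0
  volume-empty {W} empty = trans
    (sum-cong-≗ (λ x → cong (if_then degree G x else 0) (dec-false (x ∈? W) (λ x∈W → empty (x , x∈W)))))
    (sum-replicate-zero n)

  crossEdges≡volume : ∀ W → crossEdges G (toVSet W) (neighbourhood W) ≡ volume W
  crossEdges≡volume W =
    trans (sumFin≡∑ (λ x → if toVSet W x then count (λ y → neighbourhood W y ∧ adj G x y) else 0)) (sum-cong-≗ row)
    where
    row : ∀ x → (if does (x ∈? W) then count (λ y → neighbourhood W y ∧ adj G x y) else 0)
              ≡ (if does (x ∈? W) then degree G x else 0)
    row x with x ∈? W
    ... | no  _   = refl
    ... | yes x∈W = count-cong entry
      where
      entry : ∀ y → neighbourhood W y ∧ adj G x y ≡ adj G x y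
      entry y with adj G x y in xy
      ... | false = ∧-zeroʳ _
      ... | true  = trans (∧-identityʳ _)
                          (dec-true (hasNeighbourIn? W y) (x , adj-sym (subst T (sym xy) _) , x∈W))

  onIndependent : (Subset n → ℕ) → Subset n → ℕ
  onIndependent f W = if does (independent? W) then f W else 0

  onIndependent≤ : ∀ f W → onIndependent f W ≤ f W
  onIndependent≤ f W with does (independent? W)
  ... | true  = ≤-refl
  ... | false = z≤n

  onIndependent-yes : ∀ f {W} → Independent W → onIndependent f W ≡ f W
  onIndependent-yes f {W} indW = cong (if_then f W else 0) (dec-true (independent? W) indW)

  onIndependent-¬ : ∀ f {W} → ¬ Independent W → onIndependent f W ≡ 0
  onIndependent-¬ f {W} ¬indW = cong (if_then f W else 0) (dec-false (independent? W) ¬indW)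

  onIndependent-cong : ∀ {f g} → (∀ W → f W ≡ g W) → ∀ W → onIndependent f W ≡ onIndependent g W
  onIndependent-cong f≗g W = cong (if does (independent? W) then_else 0) (f≗g W)

  onIndependent-+ : ∀ f g W → onIndependent (λ W → f W + g W) W ≡ onIndependent f W + onIndependent g W
  onIndependent-+ f g W with does (independent? W)
  ... | true  = refl
  ... | false = refl

  onIndependent-<⇒ : ∀ f g W → onIndependent f W < onIndependent g W → Independent W × f W < g W
  onIndependent-<⇒ f g W = go (independent? W)
    where
    go : (ind? : Dec (Independent W)) → (if does ind? then f W else 0) < (if does ind? then g W else 0) →
         Independent W × f W < g W
    go (yes indW) fW<gW = indW , fW<gW

  ∑-onIndependent : ∀ {m} (F : Fin m → Subset n → ℕ) W →
                    ∑[ i < m ] onIndependent (F i) W ≡ onIndependent (λ W → ∑[ i < m ] F i W) W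
  ∑-onIndependent {m} F W = go (does (independent? W))
    where
    go : ∀ b → ∑[ i < m ] (if b then F i W else 0) ≡ (if b then ∑[ i < m ] F i W else 0)
    go true  = refl
    go false = sum-replicate-zero m

  coverWeight : ℕ → Fin n → Subset n → ℕ
  coverWeight K v W = K * 𝟙 (does (covered? W v))

  degreeWeight : Fin n → Subset n → ℕ
  degreeWeight v W = 2 * ((if does (v ∈? W) then degree G v else 0) + count (λ x → adj G v x ∧ does (x ∈? W)))

  ∑-coverWeight : ∀ K W → ∑[ v < n ] coverWeight K v W ≡ K * coverCount W
  ∑-coverWeight K W = sym (trans (cong (K *_) (count≡∑𝟙 covers)) (*-distribˡ-sum K (𝟙 ∘ covers)))
    where
    covers : VSet n
    covers x = does (covered? W x)

  handshake : ∀ (A : VSet n) →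
              ∑[ v < n ] count (λ x → adj G v x ∧ A x) ≡ ∑[ x < n ] (if A x then degree G x else 0)
  handshake A = begin
    ∑[ v < n ] count (λ x → adj G v x ∧ A x)    ≡⟨ sum-cong-≗ (λ v → count≡∑𝟙 (λ x → adj G v x ∧ A x)) ⟩
    ∑[ v < n ] ∑[ x < n ] 𝟙 (adj G v x ∧ A x)   ≡⟨ ∑-comm (λ v x → 𝟙 (adj G v x ∧ A x)) ⟩
    ∑[ x < n ] ∑[ v < n ] 𝟙 (adj G v x ∧ A x)   ≡⟨ sum-cong-≗ (λ x → column x (A x)) ⟩
    ∑[ x < n ] (if A x then degree G x else 0)   ∎
    where
    open ≡-Reasoning
    column : ∀ x b → ∑[ v < n ] 𝟙 (adj G v x ∧ b) ≡ (if b then degree G x else 0)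
    column x true  = trans (sum-cong-≗ (λ v → cong 𝟙 (trans (∧-identityʳ _) (Graph.sym G v x))))
                           (sym (count≡∑𝟙 (adj G x)))
    column x false = trans (sum-cong-≗ (λ v → cong 𝟙 (∧-zeroʳ (adj G v x)))) (sum-replicate-zero n)

  ∑-degreeWeight : ∀ W → ∑[ v < n ] degreeWeight v W ≡ 4 * volume W
  ∑-degreeWeight W = begin
    ∑[ v < n ] degreeWeight v W         ≡⟨ *-distribˡ-sum 2 (λ v → deg∈ v + nbrs v) ⟨
    2 * ∑[ v < n ] (deg∈ v + nbrs v)    ≡⟨ cong (2 *_) (∑-distrib-+ deg∈ nbrs) ⟩
    2 * (volume W + ∑[ v < n ] nbrs v)  ≡⟨ cong (λ t → 2 * (volume W + t)) (handshake (toVSet W)) ⟩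
    2 * (volume W + volume W)           ≡⟨ solve 1 (λ V → con 2 :* (V :+ V) := con 4 :* V) refl (volume W) ⟩
    4 * volume W                        ∎
    where
    open ≡-Reasoning
    deg∈ nbrs : Fin n → ℕ
    deg∈ v = if does (v ∈? W) then degree G v else 0
    nbrs v = count (λ x → adj G v x ∧ toVSet W x)

-- The local inequality at a vertex

module PerVertex {n} (G : Graph n) (triangleFree : TriangleFree G)
                 (k : ℕ) (v : Fin n) (2^k≤deg[v] : 2 ^ k ≤ degree G v) where

  K : ℕ
  K = 2 + k

  coverᵥ degreeᵥ cov deg : Subset n → ℕ
  coverᵥ  = coverWeight G K v
  degreeᵥ = degreeWeight G v
  cov     = onIndependent G coverᵥ
  deg     = onIndependent G degreeᵥ

  N closed far : Subset n
  N      = tabulate (adj G v)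
  closed = ⁅ v ⁆ ∪ N
  far    = ∁ closed

  free : Subset n → Subset n
  free W₁ = tabulate λ x → does (¬? (hasNeighbourIn? G W₁ x))

  #free : Subset n → ℕ
  #free W₁ = ∣ N ∩ free W₁ ∣

  free⁺ : ∀ {W₁ x} → ¬ HasNeighbourIn G W₁ x → x ∈ free W₁
  free⁺ {W₁} {x} = ∈-tabulate⁺ ∘ does⁺ (¬? (hasNeighbourIn? G W₁ x))

  free⁻ : ∀ {W₁ x} → x ∈ free W₁ → ¬ HasNeighbourIn G W₁ x
  free⁻ {W₁} {x} = does⁻ (¬? (hasNeighbourIn? G W₁ x)) ∘ ∈-tabulate⁻

  v∉N : v ∉ N
  v∉N = adj-irrefl G ∘ ∈-tabulate⁻

  v∉far : v ∉ far
  v∉far v∈far = x∈∁p⇒x∉p v∈far (x∈p∪q⁺ (inj₁ (x∈⁅x⁆ v)))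

  far⇒¬adj : ∀ {x} → x ∈ far → ¬ T (adj G v x)
  far⇒¬adj x∈far vx = x∈∁p⇒x∉p x∈far (x∈p∪q⁺ (inj₂ (∈-tabulate⁺ vx)))

  uncovered : ∀ {W₁} → W₁ ⊆ far → ¬ Covered G W₁ v
  uncovered W₁⊆far (inj₁ v∈W₁)            = v∉far (W₁⊆far v∈W₁)
  uncovered W₁⊆far (inj₂ (y , vy , y∈W₁)) = far⇒¬adj (W₁⊆far y∈W₁) vy

  ⊆free : ∀ {W₁ W} → Independent G (W₁ ∪ W) → W ⊆ free W₁
  ⊆free {W₁} {W} ind x∈W = free⁺ λ (y , xy , y∈W₁) → ind _ y (q⊆p∪q W₁ W x∈W) (p⊆p∪q W y∈W₁) xy

  independent-∪-free : ∀ {W₁ W} → Independent G W₁ → W ⊆ N → W ⊆ free W₁ → Independent G (W₁ ∪ W)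
  independent-∪-free {W₁} {W} indW₁ W⊆N W⊆free x y x∈ y∈ xy
    with x∈p∪q⁻ W₁ W x∈ | x∈p∪q⁻ W₁ W y∈
  ... | inj₁ x∈W₁ | inj₁ y∈W₁ = indW₁ x y x∈W₁ y∈W₁ xy
  ... | inj₁ x∈W₁ | inj₂ y∈W  = free⁻ (W⊆free y∈W) (x , adj-sym G xy , x∈W₁)
  ... | inj₂ x∈W  | inj₁ y∈W₁ = free⁻ (W⊆free x∈W) (y , xy , y∈W₁)
  ... | inj₂ x∈W  | inj₂ y∈W  = triangleFree v x y (∈-tabulate⁻ (W⊆N x∈W) , xy , ∈-tabulate⁻ (W⊆N y∈W))

  independent-∪-centre : ∀ {W₁} → Independent G W₁ → W₁ ⊆ far → Independent G (W₁ ∪ ⁅ v ⁆)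
  independent-∪-centre {W₁} indW₁ W₁⊆far x y x∈ y∈ xy
    with x∈p∪q⁻ W₁ ⁅ v ⁆ x∈ | x∈p∪q⁻ W₁ ⁅ v ⁆ y∈
  ... | inj₁ x∈W₁ | inj₁ y∈W₁ = indW₁ x y x∈W₁ y∈W₁ xy
  ... | inj₁ x∈W₁ | inj₂ y∈v  rewrite x∈⁅y⁆⇒x≡y v y∈v = far⇒¬adj (W₁⊆far x∈W₁) (adj-sym G xy)
  ... | inj₂ x∈v  | inj₁ y∈W₁ rewrite x∈⁅y⁆⇒x≡y v x∈v = far⇒¬adj (W₁⊆far y∈W₁) xy
  ... | inj₂ x∈v  | inj₂ y∈v  rewrite x∈⁅y⁆⇒x≡y v x∈v | x∈⁅y⁆⇒x≡y v y∈v = adj-irrefl G xy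

  cover-nonempty : ∀ {W₁ W} → W ⊆ N → Nonempty W →
                   cov (W₁ ∪ W) + cov (W₁ ∪ (⁅ v ⁆ ∪ W)) ≤ (if does (W ⊆? free W₁) then K else 0)
  cover-nonempty {W₁} {W} W⊆N (y , y∈W) = begin
    cov (W₁ ∪ W) + cov (W₁ ∪ (⁅ v ⁆ ∪ W))   ≡⟨ cong (cov (W₁ ∪ W) +_) (onIndependent-¬ G coverᵥ v∼y) ⟩
    cov (W₁ ∪ W) + 0                        ≡⟨ +-identityʳ _ ⟩
    cov (W₁ ∪ W)                            ≤⟨ bound (independent? G (W₁ ∪ W)) (W ⊆? free W₁) ⟩
    (if does (W ⊆? free W₁) then K else 0)  ∎
    where
    open ≤-Reasoning
    v∼y : ¬ Independent G (W₁ ∪ (⁅ v ⁆ ∪ W))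
    v∼y ind = ind v y (q⊆p∪q W₁ _ (p⊆p∪q W (x∈⁅x⁆ v))) (q⊆p∪q W₁ _ (q⊆p∪q ⁅ v ⁆ W y∈W))
                      (∈-tabulate⁻ (W⊆N y∈W))
    bound : (ind? : Dec (Independent G (W₁ ∪ W))) (sub? : Dec (W ⊆ free W₁)) →
            (if does ind? then coverᵥ (W₁ ∪ W) else 0) ≤ (if does sub? then K else 0)
    bound (yes _)   (yes _)    = m*𝟙b≤m K (does (covered? G (W₁ ∪ W) v))
    bound (yes ind) (no  ¬sub) = ⊥-elim (¬sub (⊆free ind))
    bound (no  _)   _          = z≤n

  cover-empty : ∀ {W₁} → W₁ ⊆ far →
                cov (W₁ ∪ ⊥) + cov (W₁ ∪ (⁅ v ⁆ ∪ ⊥)) ≤ (if does (⊥ ⊆? free W₁) then K else 0)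
  cover-empty {W₁} W₁⊆far = begin
    cov (W₁ ∪ ⊥) + cov (W₁ ∪ (⁅ v ⁆ ∪ ⊥))
      ≤⟨ +-mono-≤ (onIndependent≤ G coverᵥ _) (onIndependent≤ G coverᵥ _) ⟩
    coverᵥ (W₁ ∪ ⊥) + coverᵥ (W₁ ∪ (⁅ v ⁆ ∪ ⊥))
      ≤⟨ +-mono-≤ (≤-reflexive v-uncovered) (m*𝟙b≤m K (does (covered? G (W₁ ∪ (⁅ v ⁆ ∪ ⊥)) v))) ⟩
    0 + K
      ≡⟨ cong (if_then K else 0) (dec-true (⊥ ⊆? free W₁) ⊥⊆) ⟨
    (if does (⊥ ⊆? free W₁) then K else 0)
      ∎
    where
    open ≤-Reasoning
    v-uncovered : coverᵥ (W₁ ∪ ⊥) ≡ 0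
    v-uncovered = begin-equality
      K * 𝟙 (does (covered? G (W₁ ∪ ⊥) v))
        ≡⟨ cong (λ W → K * 𝟙 (does (covered? G W v))) (∪-identityʳ W₁) ⟩
      K * 𝟙 (does (covered? G W₁ v))
        ≡⟨ cong (λ b → K * 𝟙 b) (dec-false (covered? G W₁ v) (uncovered W₁⊆far)) ⟩
      K * 0
        ≡⟨ *-zeroʳ K ⟩
      0 ∎

  cover-pair : ∀ {W₁ W} → W₁ ⊆ far → W ⊆ N →
               cov (W₁ ∪ W) + cov (W₁ ∪ (⁅ v ⁆ ∪ W)) ≤ (if does (W ⊆? free W₁) then K else 0)
  cover-pair {W = W} W₁⊆far W⊆N with nonempty? W
  ... | yes ne    = cover-nonempty W⊆N ne
  ... | no  empty rewrite Empty-unique empty = cover-empty W₁⊆far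

  degree-neighbours : ∀ {W₁ W} → Independent G W₁ → W ⊆ N →
                      2 * (if does (W ⊆? free W₁) then ∣ W ∣ else 0) ≤ deg (W₁ ∪ W)
  degree-neighbours {W₁} {W} indW₁ W⊆N with W ⊆? free W₁
  ... | no  _      = z≤n
  ... | yes W⊆free = begin
    2 * ∣ W ∣                                          ≡⟨ cong (2 *_) (∣p∣≡count-∈ W) ⟩
    2 * count (λ x → does (x ∈? W))                    ≤⟨ *-monoʳ-≤ 2 (count-mono-≤ W⇒N∩[W₁∪W]) ⟩
    2 * count (λ x → adj G v x ∧ does (x ∈? W₁ ∪ W))   ≤⟨ *-monoʳ-≤ 2 (m≤n+m _ deg∈) ⟩
    degreeᵥ (W₁ ∪ W)                                   ≡⟨ onIndependent-yes G degreeᵥ indW₁∪W ⟨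
    deg (W₁ ∪ W)                                       ∎
    where
    open ≤-Reasoning
    deg∈ : ℕ
    deg∈ = if does (v ∈? W₁ ∪ W) then degree G v else 0
    indW₁∪W : Independent G (W₁ ∪ W)
    indW₁∪W = independent-∪-free indW₁ W⊆N W⊆free
    W⇒N∩[W₁∪W] : ∀ x → T (does (x ∈? W)) → T (adj G v x ∧ does (x ∈? W₁ ∪ W))
    W⇒N∩[W₁∪W] x x∈W = Equivalence.from T-∧
      (∈-tabulate⁻ (W⊆N (does⁻ (x ∈? W) x∈W)) , does⁺ (x ∈? W₁ ∪ W) (q⊆p∪q W₁ W (does⁻ (x ∈? W) x∈W)))

  degree-centre : ∀ {W₁} → Independent G W₁ → W₁ ⊆ far → 2 * degree G v ≤ deg (W₁ ∪ ⁅ v ⁆)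
  degree-centre {W₁} indW₁ W₁⊆far = begin
    2 * degree G v            ≤⟨ *-monoʳ-≤ 2 (m≤m+n (degree G v) nbrs) ⟩
    2 * (degree G v + nbrs)   ≡⟨ cong (λ b → 2 * ((if b then degree G v else 0) + nbrs)) v∈W₁∪v ⟨
    degreeᵥ (W₁ ∪ ⁅ v ⁆)      ≡⟨ onIndependent-yes G degreeᵥ indW₁∪v ⟨
    deg (W₁ ∪ ⁅ v ⁆)          ∎
    where
    open ≤-Reasoning
    nbrs : ℕ
    nbrs = count (λ x → adj G v x ∧ does (x ∈? W₁ ∪ ⁅ v ⁆))
    indW₁∪v : Independent G (W₁ ∪ ⁅ v ⁆)
    indW₁∪v = independent-∪-centre indW₁ W₁⊆far
    v∈W₁∪v : does (v ∈? W₁ ∪ ⁅ v ⁆) ≡ true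
    v∈W₁∪v = dec-true (v ∈? W₁ ∪ ⁅ v ⁆) (q⊆p∪q W₁ ⁅ v ⁆ (x∈⁅x⁆ v))

  sumSubsets-closed : ∀ f → sumSubsets closed f ≡ ∑[ W ⊆ N ] (f W + f (⁅ v ⁆ ∪ W))
  sumSubsets-closed f = trans (sumSubsets-insert v∉N f) (sym (sumSubsets-distrib-+ N f (f ∘ (⁅ v ⁆ ∪_))))

  cover-closed : ∀ {W₁} → W₁ ⊆ far → ∑[ W₂ ⊆ closed ] cov (W₁ ∪ W₂) ≤ 2 ^ #free W₁ * K
  cover-closed {W₁} W₁⊆far = begin
    ∑[ W₂ ⊆ closed ] cov (W₁ ∪ W₂)
      ≡⟨ sumSubsets-closed (cov ∘ (W₁ ∪_)) ⟩
    ∑[ W ⊆ N ] (cov (W₁ ∪ W) + cov (W₁ ∪ (⁅ v ⁆ ∪ W)))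
      ≤⟨ sumSubsets-mono-≤ N (λ _ → cover-pair W₁⊆far) ⟩
    ∑[ W ⊆ N ] (if does (W ⊆? free W₁) then K else 0)
      ≡⟨ sumSubsets-restrict N (free W₁) (λ _ → K) ⟩
    ∑[ W ⊆ N ∩ free W₁ ] K
      ≡⟨ sumSubsets-const (N ∩ free W₁) K ⟩
    2 ^ #free W₁ * K
      ∎
    where open ≤-Reasoning

  degree-closed : ∀ {W₁} → Independent G W₁ → W₁ ⊆ far →
                  #free W₁ * 2 ^ #free W₁ + 2 * degree G v ≤ ∑[ W₂ ⊆ closed ] deg (W₁ ∪ W₂)
  degree-closed {W₁} indW₁ W₁⊆far = begin
    #free W₁ * 2 ^ #free W₁ + 2 * degree G v
      ≡⟨ cong (_+ 2 * degree G v) (sym (2*sumSubsets-∣∣ (N ∩ free W₁))) ⟩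
    2 * (∑[ W ⊆ N ∩ free W₁ ] ∣ W ∣) + 2 * degree G v
      ≡⟨ cong (λ t → 2 * t + 2 * degree G v) (sumSubsets-restrict N (free W₁) ∣_∣) ⟨
    2 * (∑[ W ⊆ N ] (if does (W ⊆? free W₁) then ∣ W ∣ else 0)) + 2 * degree G v
      ≡⟨ cong (_+ 2 * degree G v) (*-distribˡ-sumSubsets 2 N _) ⟩
    ∑[ W ⊆ N ] (2 * (if does (W ⊆? free W₁) then ∣ W ∣ else 0)) + 2 * degree G v
      ≤⟨ +-mono-≤ (sumSubsets-mono-≤ N (λ _ → degree-neighbours indW₁)) (degree-centre indW₁ W₁⊆far) ⟩
    ∑[ W ⊆ N ] deg (W₁ ∪ W) + deg (W₁ ∪ ⁅ v ⁆)
      ≡⟨ cong (λ W → ∑[ W ⊆ N ] deg (W₁ ∪ W) + deg (W₁ ∪ W)) (∪-identityʳ ⁅ v ⁆) ⟨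
    ∑[ W ⊆ N ] deg (W₁ ∪ W) + deg (W₁ ∪ (⁅ v ⁆ ∪ ⊥))
      ≤⟨ +-monoʳ-≤ (∑[ W ⊆ N ] deg (W₁ ∪ W)) (≤-sumSubsets {M = N} (deg ∘ (W₁ ∪_) ∘ (⁅ v ⁆ ∪_)) ⊥⊆) ⟩
    ∑[ W ⊆ N ] deg (W₁ ∪ W) + ∑[ W ⊆ N ] deg (W₁ ∪ (⁅ v ⁆ ∪ W))
      ≡⟨ sumSubsets-distrib-+ N (deg ∘ (W₁ ∪_)) (λ W → deg (W₁ ∪ (⁅ v ⁆ ∪ W))) ⟨
    ∑[ W ⊆ N ] (deg (W₁ ∪ W) + deg (W₁ ∪ (⁅ v ⁆ ∪ W)))
      ≡⟨ sumSubsets-closed (deg ∘ (W₁ ∪_)) ⟨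
    ∑[ W₂ ⊆ closed ] deg (W₁ ∪ W₂)
      ∎
    where open ≤-Reasoning

  cover≤degree-closed : ∀ {W₁} → W₁ ⊆ far →
                        ∑[ W₂ ⊆ closed ] cov (W₁ ∪ W₂) ≤ ∑[ W₂ ⊆ closed ] deg (W₁ ∪ W₂)
  cover≤degree-closed {W₁} W₁⊆far with independent? G W₁
  ... | no ¬indW₁ = sumSubsets-mono-≤ closed λ W₂ _ →
    ≤-trans (≤-reflexive (onIndependent-¬ G coverᵥ (¬indW₁ ∘ independent-⊆ G (p⊆p∪q W₂)))) z≤n
  ... | yes indW₁ = let x = #free W₁ in begin
    ∑[ W₂ ⊆ closed ] cov (W₁ ∪ W₂)         ≤⟨ cover-closed W₁⊆far ⟩
    2 ^ x * K                              ≡⟨ *-comm (2 ^ x) K ⟩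
    K * 2 ^ x                              ≤⟨ [2+k]*2^x≤2*2^k+x*2^x k x ⟩
    2 * 2 ^ k + x * 2 ^ x                  ≤⟨ +-monoˡ-≤ (x * 2 ^ x) (*-monoʳ-≤ 2 2^k≤deg[v]) ⟩
    2 * degree G v + x * 2 ^ x             ≡⟨ +-comm (2 * degree G v) _ ⟩
    x * 2 ^ x + 2 * degree G v             ≤⟨ degree-closed indW₁ W₁⊆far ⟩
    ∑[ W₂ ⊆ closed ] deg (W₁ ∪ W₂)         ∎
    where open ≤-Reasoning

  cover≤degree : ∑[ W ⊆ ⊤ ] cov W ≤ ∑[ W ⊆ ⊤ ] deg W
  cover≤degree = begin
    ∑[ W ⊆ ⊤ ] cov W                               ≡⟨ split cov ⟩
    ∑[ W₁ ⊆ far ] ∑[ W₂ ⊆ closed ] cov (W₁ ∪ W₂)   ≤⟨ sumSubsets-mono-≤ far (λ _ → cover≤degree-closed) ⟩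
    ∑[ W₁ ⊆ far ] ∑[ W₂ ⊆ closed ] deg (W₁ ∪ W₂)   ≡⟨ split deg ⟨
    ∑[ W ⊆ ⊤ ] deg W                               ∎
    where
    open ≤-Reasoning
    split : ∀ f → sumSubsets ⊤ f ≡ ∑[ W₁ ⊆ far ] ∑[ W₂ ⊆ closed ] f (W₁ ∪ W₂)
    split f = trans (cong (λ M → sumSubsets M f) (sym (trans (∪-comm far closed) (p∪∁p≡⊤ closed))))
                    (sumSubsets-∪ far closed x∈∁p⇒x∉p f)

-- Averaging over independent sets

module _ {n} (G : Graph n) (triangleFree : TriangleFree G) (k : ℕ) (2^k≤deg : ∀ v → 2 ^ k ≤ degree G v) where

  scaledCover volume4 nonempty : Subset n → ℕ
  scaledCover W = (2 + k) * coverCount G W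
  volume4     W = 4 * volume G W
  nonempty    W = 𝟙 (does (nonempty? W))

  ∑scaledCover≤∑volume4 : ∑[ W ⊆ ⊤ ] onIndependent G scaledCover W ≤ ∑[ W ⊆ ⊤ ] onIndependent G volume4 W
  ∑scaledCover≤∑volume4 = begin
    ∑[ W ⊆ ⊤ ] onIndependent G scaledCover W
      ≡⟨ sumSubsets-cong ⊤ (λ W → trans (onIndependent-cong G (sym ∘ ∑-coverWeight G (2 + k)) W)
                                        (sym (∑-onIndependent G (coverWeight G (2 + k)) W))) ⟩
    ∑[ W ⊆ ⊤ ] ∑[ v < n ] onIndependent G (coverWeight G (2 + k) v) W
      ≡⟨ ∑-sumSubsets-comm ⊤ (λ v → onIndependent G (coverWeight G (2 + k) v)) ⟨
    ∑[ v < n ] ∑[ W ⊆ ⊤ ] onIndependent G (coverWeight G (2 + k) v) W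
      ≤⟨ ∑-mono-≤ (λ v → PerVertex.cover≤degree G triangleFree k v (2^k≤deg v)) ⟩
    ∑[ v < n ] ∑[ W ⊆ ⊤ ] onIndependent G (degreeWeight G v) W
      ≡⟨ ∑-sumSubsets-comm ⊤ (λ v → onIndependent G (degreeWeight G v)) ⟩
    ∑[ W ⊆ ⊤ ] ∑[ v < n ] onIndependent G (degreeWeight G v) W
      ≡⟨ sumSubsets-cong ⊤ (λ W → trans (∑-onIndependent G (degreeWeight G) W)
                                        (onIndependent-cong G (∑-degreeWeight G) W)) ⟩
    ∑[ W ⊆ ⊤ ] onIndependent G volume4 W
      ∎
    where open ≤-Reasoning

  1≤∑nonempty : Fin n → 1 ≤ ∑[ W ⊆ ⊤ ] onIndependent G nonempty W
  1≤∑nonempty v₀ = begin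
    1                                         ≡⟨ cong 𝟙 (dec-true (nonempty? ⁅ v₀ ⁆) (v₀ , x∈⁅x⁆ v₀)) ⟨
    nonempty ⁅ v₀ ⁆                           ≡⟨ onIndependent-yes G nonempty (independent-⁅⁆ G v₀) ⟨
    onIndependent G nonempty ⁅ v₀ ⁆           ≤⟨ ≤-sumSubsets (onIndependent G nonempty) ⊆⊤ ⟩
    ∑[ W ⊆ ⊤ ] onIndependent G nonempty W     ∎
    where open ≤-Reasoning

  -- Adding the indicator of nonemptiness makes the inequality strict (singletons are independent)
  -- and forces the independent set extracted below to be nonempty.
  ∑scaledCover<∑[nonempty+volume4] : Fin n →
    ∑[ W ⊆ ⊤ ] onIndependent G scaledCover W < ∑[ W ⊆ ⊤ ] onIndependent G (λ W → nonempty W + volume4 W) W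
  ∑scaledCover<∑[nonempty+volume4] v₀ = begin-strict
    ∑[ W ⊆ ⊤ ] onIndependent G scaledCover W
      ≤⟨ ∑scaledCover≤∑volume4 ⟩
    ∑[ W ⊆ ⊤ ] onIndependent G volume4 W
      <⟨ +-monoˡ-< _ (1≤∑nonempty v₀) ⟩
    ∑[ W ⊆ ⊤ ] onIndependent G nonempty W + ∑[ W ⊆ ⊤ ] onIndependent G volume4 W
      ≡⟨ sumSubsets-distrib-+ ⊤ (onIndependent G nonempty) (onIndependent G volume4) ⟨
    ∑[ W ⊆ ⊤ ] (onIndependent G nonempty W + onIndependent G volume4 W)
      ≡⟨ sumSubsets-cong ⊤ (onIndependent-+ G nonempty volume4) ⟨
    ∑[ W ⊆ ⊤ ] onIndependent G (λ W → nonempty W + volume4 W) W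
      ∎
    where open ≤-Reasoning

  denseIndependentSet : Fin n → ∃ λ W → Independent G W × Nonempty W × (2 + k) * coverCount G W ≤ 4 * volume G W
  denseIndependentSet v₀
    with sumSubsets-<⇒∃< ⊤ (onIndependent G scaledCover) (onIndependent G (λ W → nonempty W + volume4 W))
                         (∑scaledCover<∑[nonempty+volume4] v₀)
  ... | W , lt with onIndependent-<⇒ G scaledCover (λ W → nonempty W + volume4 W) W lt
  ...   | indW , cover<nonempty+volume = W , indW , select (nonempty? W) cover<nonempty+volume
    where
    select : (ne? : Dec (Nonempty W)) → scaledCover W < 𝟙 (does ne?) + volume4 W → Nonempty W × scaledCover W ≤ volume4 W
    select (yes ne)    lt = ne , m<1+n⇒m≤n lt
    select (no  empty) lt = contradiction (subst (λ t → scaledCover W < 4 * t) (volume-empty G empty) lt) (λ ())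

-- The semi-bipartition (W, N(W)) of an independent set W

module _ {n} (G : Graph n) {W : Subset n} (indW : Independent G W) where

  toVSet-stable : Stable G (toVSet W)
  toVSet-stable x y x∈W y∈W = indW x y (does⁻ (x ∈? W) x∈W) (does⁻ (y ∈? W) y∈W)

  toVSet-disjoint : Disjoint (toVSet W) (neighbourhood G W)
  toVSet-disjoint x (x∈W , x∈N) with does⁻ (hasNeighbourIn? G W x) x∈N
  ... | y , xy , y∈W = indW x y (does⁻ (x ∈? W) x∈W) y∈W xy

  coverCount≡size+size : coverCount G W ≡ size (toVSet W) + size (neighbourhood G W)
  coverCount≡size+size = count-∨ (toVSet W) (neighbourhood G W) (λ x x∈W x∈N → toVSet-disjoint x (x∈W , x∈N))

  semiBipartition : Nonempty W → SemiBipartition G (toVSet W) (neighbourhood G W)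
  semiBipartition ne = toVSet-disjoint , toVSet-stable , subst (1 ≤_) coverCount≡size+size (1≤coverCount G ne)

  avgDegAtLeastHalfLog : ∀ k {d} → Nonempty W → d ≤ 2 ^ suc k → (2 + k) * coverCount G W ≤ 4 * volume G W →
                         AvgDegAtLeastHalfLog G (toVSet W) (neighbourhood G W) d
  avgDegAtLeastHalfLog k {d} ne d≤2^[1+k] [2+k]s≤4vol =
    subst₂ ExpAtLeast (cong (4 *_) (sym (crossEdges≡volume G W))) (cong (d ^_) coverCount≡size+size)
      (expAtLeast-^ k (4 * volume G W) (1≤coverCount G ne) d≤2^[1+k] [2+k]s≤4vol)

theorem3p5 : ∀ {n} (G : Graph n) (d : ℕ) → 1 ≤ d → TriangleFree G → MinDegree G d →
    Σ (VSet n) λ V1 → Σ (VSet n) λ V2 →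
      SemiBipartition G V1 V2 × AvgDegAtLeastHalfLog G V1 V2 d
theorem3p5 G d 1≤d triangleFree (d≤deg , v₀ , _) =
  let k , 2^k≤d , d≤2^[1+k] = ∃[k]2^k≤n≤2^[1+k] d 1≤d
      W , indW , ne , bound = denseIndependentSet G triangleFree k (λ v → ≤-trans 2^k≤d (d≤deg v)) v₀
  in toVSet W , neighbourhood G W , semiBipartition G indW ne ,
     avgDegAtLeastHalfLog G indW k ne d≤2^[1+k] bound
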